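{- Let $\alpha\in\{+,-\}$ and let $G$ be a linear $\alpha$-semiradial or a sublinear $\alpha$-radial with root $r\in V(G)$. Then $G$ has no $(-\alpha,-\alpha)$-edges.
   Context: A bidirected graph $G$ is a finite graph (loops and parallel edges allowed) with maps $\partial_+,\partial_-:E(G)\to 2^{V(G)}$ such that for each edge $e$ with (possibly identical) ends $u,v$: $\partial_\alpha(e)\subseteq\{u,v\}$, $\partial_+(e)\cup\partial_-(e)=\{u,v\}$, and $\partial_+(e)\cap\partial_-(e)=\emptyset$ if $e$ is not a loop. If $u\in\partial_\alpha(e)$, the sign of $u$ over $e$ is $\alpha$; $-\alpha$ denotes the opposite sign. An edge is a $(\beta,\beta)$-edge if all its ends have sign $\beta$ over it. A walk is a sequence $W=(w_1,\dots,w_k)$, $k$ odd, with $w_i$ a vertex for odd $i$ and $w_i$ an edge joining $w_{i-1},w_{i+1}$ for even $i$; a trail has no repeated edge. $W$ is a diwalk if to each traversal of an edge $w_i$ one can assign signs to its end-occurrences equal to the signs of these vertices over $w_i$ (for a loop with one end $+$ and one end $-$, the two assigned signs are distinct), such that at every internal vertex term the signs assigned from the preceding and following edges are distinct. A ditrail is a diwalk that is a trail. For $k\ge3$ the sign of $w_1$ (resp. $w_k$) over $W$ is the sign assigned at $w_2$ (resp. $w_{k-1}$); $W$ is an $(\alpha,\beta)$-ditrail if these are $\alpha,\beta$, and an $\alpha$-ditrail if it is an $(\alpha,\beta)$-ditrail for some $\beta$; the trivial ditrail $(v)$ counts as both a $(+,-)$- and a $(-,+)$-ditrail. $G$ is an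 $\alpha$-radial with root $r$ if every $v$ has an $(\alpha,-\alpha)$-ditrail from $v$ to $r$, and an $\alpha$-semiradial with root $r$ if every $v$ has an $\alpha$-ditrail from $v$ to $r$. An $\alpha$-semiradial $G$ with root $r$ is linear if $G$ has no loop at $r$ and no $-\alpha$-ditrail from any $x\in V(G)$ to $r$ other than the trivial ditrail $(r)$; it is sublinear if there is no $(-\alpha,-\alpha)$-ditrail from any $x\in V(G)$ to $r$. A sublinear $\alpha$-radial is a sublinear $\alpha$-semiradial that is an $\alpha$-radial. -}

module Defs where

open import Data.Nat using (ℕ)
open import Data.Fin using (Fin)
open import Data.Bool using (Bool; true; false; not)
open import Data.List using (List; []; _∷_)
open import Data.List.Relation.Unary.Unique.Propositional using (Unique)
open import Data.Product using (Σ; _×_; ∃)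
open import Data.Sum using (_⊎_)
open import Relation.Binary.PropositionalEquality using (_≡_)
open import Relation.Nullary using (¬_)

data Sign : Set where
  ⊕ ⊖ : Sign

neg : Sign → Sign
neg ⊕ = ⊖
neg ⊖ = ⊕

-- A finite bidirected graph, encoded by half-edges: every edge e has two
-- end-occurrences (indexed by a Bool "side"), each with a vertex end e s
-- and the sign sgn e s of that vertex over e at that end-occurrence.
-- Then u ∈ ∂_α(e) iff u = end e s and α = sgn e s for some side s.
-- Non-loop edges: each end has a single sign (∂₊ ∩ ∂₋ = ∅).
-- Loops: (+,+), (-,-) or (+,-) (the latter = loop with one end + and one end -).
record BiGraph : Set where
  field
    nV  : ℕ
    nE  : ℕ
    end : Fin nE → Bool → Fin nV
    sgn : Fin nE → Bool → Sign

module _ (G : BiGraph) where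
  open BiGraph G

  -- Nontrivial diwalks (k ≥ 3), given by the sequence of traversed edges
  -- together with the side s at which each edge is entered (the traversal
  -- goes from end e s to end e (not s), with assigned signs sgn e s,
  -- sgn e (not s)).  Indices: start vertex, sign of start vertex over the
  -- walk, end vertex, sign of end vertex over the walk, list of edges.
  -- At every internal vertex the two assigned signs are distinct.
  data DiWalk : Fin nV → Sign → Fin nV → Sign → List (Fin nE) → Set where
    one  : (e : Fin nE) (s : Bool) →
           DiWalk (end e s) (sgn e s) (end e (not s)) (sgn e (not s)) (e ∷ [])
    cons : (e : Fin nE) (s : Bool) {y : Fin nV} {β : Sign} {es : List (Fin nE)} →
           DiWalk (end e (not s)) (neg (sgn e (not s))) y β es →
           DiWalk (end e s) (sgn e s) y β (e ∷ es)

  NontrivDiTrail : Fin nV → Sign → Fin nV → Sign → Set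
  NontrivDiTrail x α y β = Σ (List (Fin nE)) λ es → DiWalk x α y β es × Unique es

  -- (α,β)-ditrail from x to y; the trivial ditrail (x) is both a (+,-)- and
  -- a (-,+)-ditrail, i.e. an (α, neg α)-ditrail.
  DiTrail : Fin nV → Sign → Fin nV → Sign → Set
  DiTrail x α y β = (x ≡ y × β ≡ neg α) ⊎ NontrivDiTrail x α y β

  DiTrailα : Fin nV → Sign → Fin nV → Set
  DiTrailα x α y = ∃ λ β → DiTrail x α y β

  IsRadial : Sign → Fin nV → Set
  IsRadial α r = (v : Fin nV) → DiTrail v α r (neg α)

  IsSemiradial : Sign → Fin nV → Set
  IsSemiradial α r = (v : Fin nV) → DiTrailα v α r

  HasLoopAt : Fin nV → Set
  HasLoopAt r = ∃ λ (e : Fin nE) → end e true ≡ r × end e false ≡ r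

  IsLinearSemiradial : Sign → Fin nV → Set
  IsLinearSemiradial α r =
    IsSemiradial α r × ¬ HasLoopAt r ×
    ((x : Fin nV) (β : Sign) → ¬ NontrivDiTrail x (neg α) r β)

  IsSublinearSemiradial : Sign → Fin nV → Set
  IsSublinearSemiradial α r =
    IsSemiradial α r × ((x : Fin nV) → ¬ DiTrail x (neg α) r (neg α))

  IsSublinearRadial : Sign → Fin nV → Set
  IsSublinearRadial α r = IsSublinearSemiradial α r × IsRadial α r

  IsEdgeOfType : Sign → Fin nE → Set
  IsEdgeOfType β e = sgn e true ≡ β × sgn e false ≡ β

module Submission where

-- Let e be a (γ,γ)-edge with ends u = end e true and
-- v = end e false, and let P be a ditrail leaving v with sign -γ and ending
-- at y with sign β.  Then some vertex has a NONTRIVIAL (γ,β)-ditrail to y: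
--   * if P is trivial, the edge e alone is a (γ,γ)-ditrail from u to v = y
--     (and β = γ for the trivial ditrail);
--   * if P uses e, the part of P from its traversal of e onwards starts
--     with sign γ, because both ends of e have sign γ;
--   * otherwise e followed by P is a ditrail from u with sign γ.
-- The theorem applies this with γ = -α and P the α-ditrail from v to the
-- root r given by the (semi)radial property: in the linear case the
-- resulting nontrivial -α-ditrail to r is forbidden outright, and in the
-- sublinear radial case P ends with sign -α, so the resulting ditrail is a
-- forbidden (-α,-α)-ditrail.

open import Defs
open import Data.Fin using (Fin; _≟_)
open import Data.Bool using (true; false)
open import Data.List using ([]; _∷_)
open import Data.List.Relation.Unary.Any using (here; there; any?)
open import Data.List.Relation.Unary.All using ([])
open import Data.List.Relation.Unary.All.Properties using (¬Any⇒All¬)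
open import Data.List.Relation.Unary.AllPairs using ([]; _∷_)
open import Data.List.Membership.Propositional using (_∈_)
open import Data.List.Relation.Unary.Unique.Propositional using (Unique)
open import Data.Product using (_,_; ∃; proj₁; proj₂)
open import Data.Empty using (⊥)
open import Data.Sum using (_⊎_; inj₁; inj₂)
open import Relation.Nullary using (¬_; yes; no)
open import Relation.Binary.PropositionalEquality using (_≡_; refl; subst; sym; trans; cong)

neg-involutive : ∀ α → neg (neg α) ≡ α
neg-involutive ⊕ = refl
neg-involutive ⊖ = refl

module _ (G : BiGraph) where
  open BiGraph G

  NontrivDiTrailInto : Sign → Fin nV → Sign → Set
  NontrivDiTrailInto γ y β = ∃ λ x → NontrivDiTrail G x γ y β

  module _ {γ : Sign} {e : Fin nE} (ty : IsEdgeOfType G γ e) where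

    sideSign : ∀ s → sgn e s ≡ γ
    sideSign true  = proj₁ ty
    sideSign false = proj₂ ty

    startsWithγ : ∀ s {y β es} →
                  DiWalk G (end e s) (sgn e s) y β es → DiWalk G (end e s) γ y β es
    startsWithγ s = subst (λ δ → DiWalk G (end e s) δ _ _ _) (sideSign s)

    edgeDiTrail : NontrivDiTrail G (end e true) γ (end e false) γ
    edgeDiTrail = e ∷ [] , walk , [] ∷ []
      where
      walk : DiWalk G (end e true) γ (end e false) γ (e ∷ [])
      walk = subst (λ β → DiWalk G (end e true) γ (end e false) β (e ∷ []))
                   (sideSign false) (startsWithγ true (DiWalk.one e true))

    -- A ditrail through e contains, from its traversal of e onwards, a
    -- nontrivial γ-ditrail to the same endpoint with the same final sign.
    suffixFromEdge : ∀ {x δ y β es} → DiWalk G x δ y β es → Unique es → e ∈ es →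
                     NontrivDiTrailInto γ y β
    suffixFromEdge (DiWalk.one .e s) u (here refl) =
      end e s , e ∷ [] , startsWithγ s (DiWalk.one e s) , u
    suffixFromEdge (DiWalk.cons .e s w) u (here refl) =
      end e s , _ , startsWithγ s (DiWalk.cons e s w) , u
    suffixFromEdge (DiWalk.cons _ _ w) (_ ∷ u) (there e∈es) = suffixFromEdge w u e∈es

    prependEdge : ∀ {y β es} → DiWalk G (end e false) (neg γ) y β es → Unique es →
                  ¬ e ∈ es → NontrivDiTrail G (end e true) γ y β
    prependEdge {es = es} w u e∉es =
      e ∷ es , startsWithγ true (DiWalk.cons e true w′) , ¬Any⇒All¬ es e∉es ∷ u
      where
      leavingSign : neg γ ≡ neg (sgn e false)
      leavingSign = cong neg (sym (sideSign false))

      w′ : DiWalk G (end e false) (neg (sgn e false)) _ _ es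
      w′ = subst (λ δ → DiWalk G (end e false) δ _ _ es) leavingSign w

    extendThroughEdge : ∀ {y β} → DiTrail G (end e false) (neg γ) y β →
                        NontrivDiTrailInto γ y β
    extendThroughEdge (inj₁ (refl , β≡γ)) =
      end e true , subst (NontrivDiTrail G (end e true) γ (end e false))
                         (sym (trans β≡γ (neg-involutive γ))) edgeDiTrail
    extendThroughEdge (inj₂ (es , w , u)) with any? (e ≟_) es
    ... | yes e∈es = suffixFromEdge w u e∈es
    ... | no  e∉es = end e true , prependEdge w u e∉es

lemma11p4 : (G : BiGraph) (α : Sign) (r : Fin (BiGraph.nV G)) →
            IsLinearSemiradial G α r ⊎ IsSublinearRadial G α r →
            (e : Fin (BiGraph.nE G)) → ¬ IsEdgeOfType G (neg α) e
lemma11p4 G α r hyp e ty = absurd hyp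
  where
  open BiGraph G

  asNegNeg : ∀ {y β} → DiTrail G (end e false) α y β → DiTrail G (end e false) (neg (neg α)) y β
  asNegNeg = subst (λ δ → DiTrail G (end e false) δ _ _) (sym (neg-involutive α))

  absurd : IsLinearSemiradial G α r ⊎ IsSublinearRadial G α r → ⊥
  absurd (inj₁ (semiradial , _ , noNegDiTrail))
    with semiradial (end e false)
  ... | β , P with extendThroughEdge G ty (asNegNeg P)
  ...   | x , T = noNegDiTrail x β T
  absurd (inj₂ ((_ , noNegNegDiTrail) , radial))
    with extendThroughEdge G ty (asNegNeg (radial (end e false)))
  ... | x , T = noNegNegDiTrail x (inj₂ T)
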